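{- Let $S=\{x_1,\ldots,x_n\}$ be a gcd-closed set of distinct positive integers and let $1\le i,j\le n$. If $x_i\in D_S(x_j)$ and $D_S(x_j)\cap D_i=\emptyset$, then $c_{ij}=l_i-1$, where $l_i=|D_i\cap G_S(x_j)|$.
   Context: $\mu$ is the Möbius function. $S$ is gcd-closed if $\gcd(x,y)\in S$ for all $x,y\in S$. For $x<y$ in $S$, $x$ is a greatest-type divisor of $y$ in $S$ if $x\mid y$ and $x\mid z\mid y$, $z\in S$ imply $z\in\{x,y\}$; $G_S(y)$ is the set of greatest-type divisors of $y$ in $S$. If $G_S(x_k)=\{y_{k,1},\ldots,y_{k,m}\}$, then $D_S(x_k)=\{\gcd(y_{k,i_1},\ldots,y_{k,i_r}): 2\le r\le m,\ 1\le i_1<\cdots<i_r\le m\}$. For $x_r\in S$, $D_r=\{x\in S: x_r\mid x,\ x>x_r\}$. $c_{ij}=\sum\mu(d)$ over positive integers $d$ with $dx_i\mid x_j$ and $dx_i\nmid x_t$ for every $x_t\in S$ with $x_t<x_j$. -}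

module Defs where

open import Data.Nat using (ℕ; zero; suc; _*_; _<_; _≤_; _<?_; _≟_)
open import Data.Nat.Divisibility using (_∣_; _∣?_)
open import Data.Nat.GCD using (gcd)
open import Data.Nat.Primality using (Prime; prime?)
open import Data.Integer using (ℤ) renaming (_+_ to _+ℤ_; _*_ to _*ℤ_; -_ to -ℤ_)
import Data.Integer as ℤ
open import Data.Fin using (Fin)
open import Data.Fin.Properties using (all?; any?)
open import Data.List using (List; []; _∷_; length; filter; map; foldr; allFin; upTo)
open import Data.List.Relation.Unary.All using (All)
open import Data.List.Relation.Unary.Unique.Propositional using (Unique)
open import Data.List.Membership.Propositional using (_∈_)
open import Data.Product using (_×_; ∃; _,_)
open import Data.Sum using (_⊎_)
open import Relation.Nullary using (Dec; ¬_; yes; no)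
open import Relation.Nullary.Decidable using (_×-dec_; _⊎-dec_; _→-dec_; ¬?)
open import Relation.Binary.PropositionalEquality using (_≡_)
open import Function using (_∘_)

sumℤ : List ℤ → ℤ
sumℤ = foldr _+ℤ_ (ℤ.+ 0)

range1 : ℕ → List ℕ
range1 m = map suc (upTo m)

-- Möbius function (μ(0) := 0 by convention; only used at positive arguments):
-- μ(d) = 0 if k² ∣ d for some 2 ≤ k ≤ d, otherwise (-1)^(number of primes p ≤ d with p ∣ d).
μ : ℕ → ℤ
μ zero = ℤ.+ 0
μ (suc m) with any? {n = suc (suc m)} (λ (k : Fin (suc (suc m))) → (2 Data.Nat.≤? Data.Fin.toℕ k) ×-dec ((Data.Fin.toℕ k * Data.Fin.toℕ k) ∣? suc m))
... | yes _ = ℤ.+ 0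
... | no  _ = sign (length (filter (λ p → prime? p ×-dec (p ∣? suc m)) (range1 (suc m))))
  where
  sign : ℕ → ℤ
  sign zero    = ℤ.+ 1
  sign (suc r) = -ℤ_ (sign r)

-- The set S = {x_1,...,x_n} given as an injective indexing x : Fin n → ℕ
-- of positive integers.
Distinct : ∀ {n} → (Fin n → ℕ) → Set
Distinct x = ∀ i j → x i ≡ x j → i ≡ j

Positive : ∀ {n} → (Fin n → ℕ) → Set
Positive x = ∀ i → 0 < x i

GcdClosed : ∀ {n} → (Fin n → ℕ) → Set
GcdClosed x = ∀ i j → ∃ λ k → x k ≡ gcd (x i) (x j)

-- x_k is a greatest-type divisor of x_j in S, i.e. x_k ∈ G_S(x_j)
IsGTD : ∀ {n} → (Fin n → ℕ) → Fin n → Fin n → Set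
IsGTD x k j = (x k < x j) × (x k ∣ x j) ×
  (∀ t → (x k ∣ x t) × (x t ∣ x j) → (x t ≡ x k) ⊎ (x t ≡ x j))

isGTD? : ∀ {n} (x : Fin n → ℕ) (k j : Fin n) → Dec (IsGTD x k j)
isGTD? x k j = (x k <? x j) ×-dec ((x k ∣? x j) ×-dec
  all? (λ t → ((x k ∣? x t) ×-dec (x t ∣? x j)) →-dec ((x t ≟ x k) ⊎-dec (x t ≟ x j))))

-- gcd of a list of naturals (gcd of the empty list is 0, the neutral element)
gcdList : List ℕ → ℕ
gcdList = foldr gcd 0

InDS : ∀ {n} → (Fin n → ℕ) → Fin n → ℕ → Set
InDS {n} x j z = ∃ λ (L : List (Fin n)) →
  Unique L × (2 ≤ length L) × All (λ k → IsGTD x k j) L × (gcdList (map x L) ≡ z)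

InD : ∀ {n} → (Fin n → ℕ) → Fin n → ℕ → Set
InD {n} x r z = (∃ λ (k : Fin n) → x k ≡ z) × (x r ∣ z) × (x r < z)

-- l_i = |D_i ∩ G_S(x_j)|, counted over indices k (x is injective)
lCount : ∀ {n} → (Fin n → ℕ) → Fin n → Fin n → ℕ
lCount x i j = length (filter (λ k → ((x i ∣? x k) ×-dec (x i <? x k)) ×-dec isGTD? x k j) (allFin _))

-- c_ij = Σ μ(d) over positive d with d x_i ∣ x_j and d x_i ∤ x_t for every x_t < x_j.
-- Such d satisfy d ≤ x_j (as x_j > 0), so d ranges over [1 .. x_j].
cCoeff : ∀ {n} → (Fin n → ℕ) → Fin n → Fin n → ℤ
cCoeff x i j = sumℤ (map μ (filter
  (λ d → ((d * x i) ∣? x j) ×-dec all? (λ t → (x t <? x j) →-dec ¬? ((d * x i) ∣? x t)))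
  (range1 (x j))))

module Submission where

-- Write a = x_i, y = x_j and let K be the set of greatest-type divisors of y
-- that are proper multiples of a, so |K| = l_i.  Call d admissible when
-- d·a ∣ y and d·a divides no element of S below y.  For every d ≥ 1,
--   [d admissible]·μ(d) = [d·a ∣ y]·μ(d) - Σ_{k∈K} [d·a ∣ x_k]·μ(d) + (|K| - 1)·[d = 1].
-- For d ≥ 2 this holds because at most one x_k (k ∈ K) is a multiple of d·a
-- (the gcd of two would lie in D_S(y) ∩ D_i), and if none is then d is
-- admissible (an x_t < y divisible by d·a leads, through gcd(x_t, y), to a
-- greatest-type divisor of y in K divisible by d·a).  Summing over d ≤ y, the
-- first two sums are Möbius sums over the divisors of y/a ≥ 2 and x_k/a ≥ 2,
-- hence vanish, which leaves c_ij = |K| - 1.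

open import Defs
open import Data.Nat as ℕ using (ℕ; zero; suc; _+_; _*_; _∸_; _≤_; _<_; _<?_; z≤n; s≤s)
open import Data.Nat.Induction using (<-wellFounded)
open import Induction.WellFounded using (Acc; acc)
import Data.Nat.Properties as ℕP
open import Data.Nat.Divisibility
open import Data.Nat.GCD using (gcd; gcd[m,n]∣m; gcd[m,n]∣n; gcd-greatest; gcd-identityʳ)
open import Data.Nat.Coprimality using (Coprime; coprime-divisor)
open import Data.Nat.Primality
open import Data.Nat.Primality.Factorisation using (factorise)
open import Data.Nat.ListAction using (product)
open import Data.Integer using (ℤ; +_; -_; _-_) renaming (_+_ to _+ᶻ_; _*_ to _*ᶻ_)
import Data.Integer.Properties as ℤP
open import Data.Integer.Tactic.RingSolver using (solve-∀)
open import Data.List using (List; []; _∷_; length; filter; map; allFin)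
open import Data.List.Properties using (map-upTo; map-∘)
open import Data.List.Membership.Propositional using (_∈_; find; lose)
open import Data.List.Membership.Propositional.Properties using (∈-filter⁺; ∈-filter⁻; ∈-allFin)
open import Data.List.Relation.Unary.Any using (Any; here; there; any?)
open import Data.List.Relation.Unary.All as All using ([]; _∷_)
open import Data.List.Relation.Unary.AllPairs using ([]; _∷_)
open import Data.List.Relation.Unary.Unique.Propositional using (Unique)
import Data.List.Relation.Unary.Unique.Propositional.Properties as Unique
open import Data.Fin using (Fin; toℕ; fromℕ<) renaming (_≟_ to _≟ᶠ_)
open import Data.Fin.Properties using (all?; toℕ-fromℕ<; ¬∀⟶∃¬) renaming (any? to anyFin?)
open import Data.Product using (_×_; _,_; ∃; proj₁; proj₂)
open import Data.Sum using (_⊎_; inj₁; inj₂; [_,_]′)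
open import Relation.Nullary using (Dec; yes; no; ¬_)
open import Relation.Nullary.Decidable using (_×-dec_; _⊎-dec_; _→-dec_; ¬?)
open import Relation.Unary using (Decidable)
open import Relation.Binary.PropositionalEquality
open import Data.Empty using (⊥-elim)
open import Function using (_∘_)

∣⇒≤⁺ : ∀ {m n} → 0 < n → m ∣ n → m ≤ n
∣⇒≤⁺ 0<n = ∣⇒≤ {{ℕ.>-nonZero 0<n}}

guard : ∀ {P : Set} → Dec P → ℤ → ℤ
guard (yes _) z = z
guard (no _)  z = + 0

guard-yes : ∀ {P : Set} (P? : Dec P) z → P → guard P? z ≡ z
guard-yes (yes _)  z _ = refl
guard-yes (no ¬p) z p = ⊥-elim (¬p p)

guard-no : ∀ {P : Set} (P? : Dec P) z → ¬ P → guard P? z ≡ + 0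
guard-no (yes p) z ¬p = ⊥-elim (¬p p)
guard-no (no _)  z _  = refl

guard-split : ∀ {P Q : Set} (P? : Dec P) (Q? : Dec Q) z →
  guard P? z ≡ guard (P? ×-dec ¬? Q?) z +ᶻ guard (P? ×-dec Q?) z
guard-split (yes _) (yes _) z = sym (ℤP.+-identityˡ z)
guard-split (yes _) (no _)  z = sym (ℤP.+-identityʳ z)
guard-split (no _)  Q?      z = refl

guard-iff : ∀ {P Q : Set} (P? : Dec P) (Q? : Dec Q) z → (P → Q) → (Q → P) → guard P? z ≡ guard Q? z
guard-iff (yes _) (yes _) z _ _ = refl
guard-iff (yes p) (no ¬q) z f _ = ⊥-elim (¬q (f p))
guard-iff (no ¬p) (yes q) z _ g = ⊥-elim (¬p (g q))
guard-iff (no _)  (no _)  z _ _ = refl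

guard-0 : ∀ {P : Set} (P? : Dec P) → guard P? (+ 0) ≡ + 0
guard-0 (yes _) = refl
guard-0 (no _)  = refl

Σ₁ : (ℕ → ℤ) → ℕ → ℤ
Σ₁ f zero    = + 0
Σ₁ f (suc n) = f 1 +ᶻ Σ₁ (f ∘ suc) n

Σ₁-cong : ∀ n (f g : ℕ → ℤ) → (∀ d → 1 ≤ d → d ≤ n → f d ≡ g d) → Σ₁ f n ≡ Σ₁ g n
Σ₁-cong zero    f g h = refl
Σ₁-cong (suc n) f g h = cong₂ _+ᶻ_ (h 1 (s≤s z≤n) (s≤s z≤n))
  (Σ₁-cong n (f ∘ suc) (g ∘ suc) (λ d _ d≤n → h (suc d) (s≤s z≤n) (s≤s d≤n)))

Σ₁-zero : ∀ n (f : ℕ → ℤ) → (∀ d → 1 ≤ d → d ≤ n → f d ≡ + 0) → Σ₁ f n ≡ + 0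
Σ₁-zero zero    f h = refl
Σ₁-zero (suc n) f h = cong₂ _+ᶻ_ (h 1 (s≤s z≤n) (s≤s z≤n))
  (Σ₁-zero n (f ∘ suc) (λ d _ d≤n → h (suc d) (s≤s z≤n) (s≤s d≤n)))

Σ₁-+ : ∀ n (f g : ℕ → ℤ) → Σ₁ (λ d → f d +ᶻ g d) n ≡ Σ₁ f n +ᶻ Σ₁ g n
Σ₁-+ zero    f g = refl
Σ₁-+ (suc n) f g = begin
    (f 1 +ᶻ g 1) +ᶻ Σ₁ (λ d → f (suc d) +ᶻ g (suc d)) n
  ≡⟨ cong ((f 1 +ᶻ g 1) +ᶻ_) (Σ₁-+ n (f ∘ suc) (g ∘ suc)) ⟩
    (f 1 +ᶻ g 1) +ᶻ (Σ₁ (f ∘ suc) n +ᶻ Σ₁ (g ∘ suc) n)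
  ≡⟨ interchange (f 1) (g 1) _ _ ⟩
    (f 1 +ᶻ Σ₁ (f ∘ suc) n) +ᶻ (g 1 +ᶻ Σ₁ (g ∘ suc) n) ∎
  where
  open ≡-Reasoning
  interchange : ∀ a b c d → (a +ᶻ b) +ᶻ (c +ᶻ d) ≡ (a +ᶻ c) +ᶻ (b +ᶻ d)
  interchange = solve-∀

Σ₁-neg : ∀ n (f : ℕ → ℤ) → Σ₁ (λ d → - f d) n ≡ - Σ₁ f n
Σ₁-neg zero    f = refl
Σ₁-neg (suc n) f = trans (cong (- f 1 +ᶻ_) (Σ₁-neg n (f ∘ suc))) (sym (ℤP.neg-distrib-+ (f 1) _))

Σ₁-scale : ∀ n c (f : ℕ → ℤ) → Σ₁ (λ d → c *ᶻ f d) n ≡ c *ᶻ Σ₁ f n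
Σ₁-scale zero    c f = sym (ℤP.*-zeroʳ c)
Σ₁-scale (suc n) c f = trans (cong (c *ᶻ f 1 +ᶻ_) (Σ₁-scale n c (f ∘ suc))) (sym (ℤP.*-distribˡ-+ c (f 1) _))

Σ₁-split : ∀ a b (f : ℕ → ℤ) → Σ₁ f (a + b) ≡ Σ₁ f a +ᶻ Σ₁ (λ d → f (a + d)) b
Σ₁-split zero    b f = sym (ℤP.+-identityˡ _)
Σ₁-split (suc a) b f = trans (cong (f 1 +ᶻ_) (Σ₁-split a b (f ∘ suc))) (sym (ℤP.+-assoc (f 1) _ _))

Σ₁-beyond : ∀ n M (f : ℕ → ℤ) → n ≤ M → (∀ d → n < d → f d ≡ + 0) → Σ₁ f M ≡ Σ₁ f n
Σ₁-beyond zero    M       f _         h = Σ₁-zero M f (λ d 1≤d _ → h d 1≤d)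
Σ₁-beyond (suc n) (suc M) f (s≤s n≤M) h =
  cong (f 1 +ᶻ_) (Σ₁-beyond n M (f ∘ suc) n≤M (λ d n<d → h (suc d) (s≤s n<d)))

Σ₁-single : ∀ n p (f : ℕ → ℤ) → 1 ≤ p → p ≤ n →
  (∀ d → 1 ≤ d → d ≤ n → d ≢ p → f d ≡ + 0) → Σ₁ f n ≡ f p
Σ₁-single (suc n) (suc zero) f _ _ h = trans
  (cong (f 1 +ᶻ_) (Σ₁-zero n (f ∘ suc) (λ d 1≤d d≤n → h (suc d) (s≤s z≤n) (s≤s d≤n) (λ e → ℕP.<⇒≢ 1≤d (sym (ℕP.suc-injective e))))))
  (ℤP.+-identityʳ (f 1))
Σ₁-single (suc n) (suc (suc p)) f _ (s≤s p≤n) h = trans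
  (cong (_+ᶻ Σ₁ (f ∘ suc) n) (h 1 (s≤s z≤n) (s≤s z≤n) (λ ())))
  (trans (ℤP.+-identityˡ _) (Σ₁-single n (suc p) (f ∘ suc) (s≤s z≤n) p≤n
    (λ d _ d≤n d≢ → h (suc d) (s≤s z≤n) (s≤s d≤n) (d≢ ∘ ℕP.suc-injective))))

Σ₁-multiples : ∀ p K (f : ℕ → ℤ) → 1 ≤ p → (∀ d → ¬ (p ∣ d) → f d ≡ + 0) →
  Σ₁ f (K * p) ≡ Σ₁ (λ e → f (e * p)) K
Σ₁-multiples p zero    f 1≤p h = refl
Σ₁-multiples p (suc K) f 1≤p h = trans (Σ₁-split p (K * p) f) (cong₂ _+ᶻ_ first-block rest)
  where
  first-block : Σ₁ f p ≡ f (1 * p)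
  first-block = trans
    (Σ₁-single p p f 1≤p ℕP.≤-refl (λ d 1≤d d≤p d≢p → h d (λ p∣d → d≢p (ℕP.≤-antisym d≤p (∣⇒≤⁺ 1≤d p∣d)))))
    (cong f (sym (ℕP.*-identityˡ p)))
  rest : Σ₁ (λ d → f (p + d)) (K * p) ≡ Σ₁ (λ e → f (suc e * p)) K
  rest = Σ₁-multiples p K (λ d → f (p + d)) 1≤p
    (λ d ¬p∣d → h (p + d) (λ p∣p+d → ¬p∣d (∣m+n∣m⇒∣n p∣p+d ∣-refl)))

sumℤ-zero : ∀ {A : Set} (f : A → ℤ) (K : List A) → (∀ k → k ∈ K → f k ≡ + 0) → sumℤ (map f K) ≡ + 0
sumℤ-zero f []      h = refl
sumℤ-zero f (k ∷ K) h = cong₂ _+ᶻ_ (h k (here refl)) (sumℤ-zero f K (λ k' m → h k' (there m)))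

sumℤ-ones : ∀ {A : Set} (f : A → ℤ) (K : List A) → (∀ k → k ∈ K → f k ≡ + 1) → sumℤ (map f K) ≡ + length K
sumℤ-ones f []      h = refl
sumℤ-ones f (k ∷ K) h = trans (cong₂ _+ᶻ_ (h k (here refl)) (sumℤ-ones f K (λ k' m → h k' (there m))))
  (sym (ℤP.pos-+ 1 (length K)))

sumℤ-filter : ∀ {P : ℕ → Set} (P? : Decidable P) (g : ℕ → ℤ) (ds : List ℕ) →
  sumℤ (map g (filter P? ds)) ≡ sumℤ (map (λ d → guard (P? d) (g d)) ds)
sumℤ-filter P? g []       = refl
sumℤ-filter P? g (d ∷ ds) with P? d
... | yes _ = cong (g d +ᶻ_) (sumℤ-filter P? g ds)
... | no _  = trans (sumℤ-filter P? g ds) (sym (ℤP.+-identityˡ _))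

range1-suc : ∀ n → range1 (suc n) ≡ 1 ∷ map suc (range1 n)
range1-suc n = cong (λ ds → 1 ∷ map suc ds) (sym (map-upTo suc n))

Σ₁-as-list : ∀ n (f : ℕ → ℤ) → Σ₁ f n ≡ sumℤ (map f (range1 n))
Σ₁-as-list zero    f = refl
Σ₁-as-list (suc n) f = begin
    f 1 +ᶻ Σ₁ (f ∘ suc) n
  ≡⟨ cong (f 1 +ᶻ_) (Σ₁-as-list n (f ∘ suc)) ⟩
    f 1 +ᶻ sumℤ (map (f ∘ suc) (range1 n))
  ≡⟨ cong (λ xs → f 1 +ᶻ sumℤ xs) (map-∘ (range1 n)) ⟩
    sumℤ (map f (1 ∷ map suc (range1 n)))
  ≡⟨ cong (sumℤ ∘ map f) (sym (range1-suc n)) ⟩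
    sumℤ (map f (range1 (suc n))) ∎
  where open ≡-Reasoning

Σ₁-filter : ∀ {P : ℕ → Set} (P? : Decidable P) (g : ℕ → ℤ) n →
  sumℤ (map g (filter P? (range1 n))) ≡ Σ₁ (λ d → guard (P? d) (g d)) n
Σ₁-filter P? g n = trans (sumℤ-filter P? g (range1 n)) (sym (Σ₁-as-list n _))

Σ₁-count : ∀ {P : ℕ → Set} (P? : Decidable P) n →
  + length (filter P? (range1 n)) ≡ Σ₁ (λ d → guard (P? d) (+ 1)) n
Σ₁-count P? n = trans (sym (sumℤ-ones (λ _ → + 1) (filter P? (range1 n)) (λ _ _ → refl))) (Σ₁-filter P? (λ _ → + 1) n)

Σ₁-sumℤ : ∀ {A : Set} (F : A → ℕ → ℤ) (K : List A) M →
  Σ₁ (λ d → sumℤ (map (λ k → F k d) K)) M ≡ sumℤ (map (λ k → Σ₁ (F k) M) K)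
Σ₁-sumℤ F []      M = Σ₁-zero M _ (λ _ _ _ → refl)
Σ₁-sumℤ F (k ∷ K) M = trans (Σ₁-+ M (F k) _) (cong (Σ₁ (F k) M +ᶻ_) (Σ₁-sumℤ F K M))

sumℤ-unique : ∀ {A : Set} {B : A → Set} (B? : ∀ k → Dec (B k)) z (K : List A) k₀ → Unique K →
  k₀ ∈ K → B k₀ → (∀ k → k ∈ K → B k → k ≡ k₀) → sumℤ (map (λ k → guard (B? k) z) K) ≡ z
sumℤ-unique B? z (k ∷ K) k₀ (k∉K ∷ uK) k₀∈ Bk₀ only with B? k
... | yes Bk = trans (cong (z +ᶻ_) (sumℤ-zero _ K others-vanish)) (ℤP.+-identityʳ z)
  where
  others-vanish : ∀ k' → k' ∈ K → guard (B? k') z ≡ + 0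
  others-vanish k' k'∈K = guard-no (B? k') z
    (λ Bk' → All.lookup k∉K k'∈K (trans (only k (here refl) Bk) (sym (only k' (there k'∈K) Bk'))))
... | no ¬Bk with k₀∈
...   | here refl  = ⊥-elim (¬Bk Bk₀)
...   | there k₀∈K = trans (ℤP.+-identityˡ _) (sumℤ-unique B? z K k₀ uK k₀∈K Bk₀ (λ k' m → only k' (there m)))

prime≥2 : ∀ {p} → Prime p → 2 ≤ p
prime≥2 {0}           pr = ⊥-elim (¬prime[0] pr)
prime≥2 {1}           pr = ⊥-elim (¬prime[1] pr)
prime≥2 {suc (suc _)} _  = s≤s (s≤s z≤n)

¬∣⇒coprime : ∀ {p d} → Prime p → ¬ p ∣ d → Coprime d p
¬∣⇒coprime pr ¬p∣d (c∣d , c∣p) with prime⇒irreducible pr c∣p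
... | inj₁ c≡1  = c≡1
... | inj₂ refl = ⊥-elim (¬p∣d c∣d)

square∣⇒square∣ : ∀ {p e k} → Prime p → ¬ p ∣ e → k * k ∣ e * p → k * k ∣ e
square∣⇒square∣ {p} {e} {k} pr ¬p∣e kk∣ep with p ∣? k
... | yes p∣k = ⊥-elim (¬p∣e (*-cancelʳ-∣ p {{prime⇒nonZero pr}} (∣-trans (*-pres-∣ p∣k p∣k) kk∣ep)))
... | no ¬p∣k = coprime-divisor (¬∣⇒coprime pr ¬p∣kk) (subst (k * k ∣_) (ℕP.*-comm e p) kk∣ep)
  where
  ¬p∣kk : ¬ p ∣ k * k
  ¬p∣kk p∣kk = [ ¬p∣k , ¬p∣k ]′ (euclidsLemma k k pr p∣kk)

-- The test performed by μ (suc m): a factor k ≥ 2 whose square divides suc m.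
SquareFactor : ℕ → Set
SquareFactor m = ∃ λ (k : Fin (suc (suc m))) → (2 ≤ toℕ k) × (toℕ k * toℕ k ∣ suc m)

-- The decision procedure used by μ; abstracting over it computes μ (suc m).
squareFactor? : ∀ m → Dec (SquareFactor m)
squareFactor? m = anyFin? (λ (k : Fin (suc (suc m))) → (2 ℕ.≤? toℕ k) ×-dec ((toℕ k * toℕ k) ∣? suc m))

-- Every k ≥ 2 with k² ∣ suc m is a witness for the test (k ≤ k² ≤ suc m).
squareFactor : ∀ m k → 2 ≤ k → k * k ∣ suc m → SquareFactor m
squareFactor m k 2≤k kk∣ = fromℕ< k<2+m , subst (λ z → (2 ≤ z) × (z * z ∣ suc m)) (sym (toℕ-fromℕ< k<2+m)) (2≤k , kk∣)
  where
  k<2+m : k < suc (suc m)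
  k<2+m = s≤s (ℕP.≤-trans (ℕP.m≤m*n k k {{ℕ.>-nonZero (ℕP.≤-trans (s≤s z≤n) 2≤k)}}) (∣⇒≤ kk∣))

μ-squareful : ∀ n k → 0 < n → 2 ≤ k → k * k ∣ n → μ n ≡ + 0
μ-squareful (suc m) k _ 2≤k kk∣ with squareFactor? m
... | yes _  = refl
... | no ¬sq = ⊥-elim (¬sq (squareFactor m k 2≤k kk∣))

-- ω n: the number of primes dividing n, as counted inside μ.
ω : ℕ → ℕ
ω n = length (filter (λ q → prime? q ×-dec (q ∣? n)) (range1 n))

prime∣product : ∀ {p q} e → Prime p → Prime q → q ∣ e * p → q ∣ e ⊎ q ≡ p
prime∣product e pr prq q∣ep with euclidsLemma e _ prq q∣ep
... | inj₁ q∣e = inj₁ q∣e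
... | inj₂ q∣p with prime⇒irreducible pr q∣p
...   | inj₁ refl = ⊥-elim (¬prime[1] prq)
...   | inj₂ q≡p  = inj₂ q≡p

ω-step : ∀ p e → Prime p → ¬ p ∣ e → 0 < e → ω (e * p) ≡ suc (ω e)
ω-step p e pr ¬p∣e 0<e = ℤP.+-injective (begin
    + ω (e * p)
  ≡⟨ Σ₁-count (λ q → prime? q ×-dec (q ∣? e * p)) (e * p) ⟩
    Σ₁ (λ q → guard (prime? q ×-dec (q ∣? e * p)) (+ 1)) (e * p)
  ≡⟨ Σ₁-cong (e * p) _ _ (λ q _ _ → indicator q) ⟩
    Σ₁ (λ q → guard (prime? q ×-dec (q ∣? e)) (+ 1) +ᶻ guard (q ℕ.≟ p) (+ 1)) (e * p)
  ≡⟨ Σ₁-+ (e * p) _ _ ⟩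
    Σ₁ (λ q → guard (prime? q ×-dec (q ∣? e)) (+ 1)) (e * p) +ᶻ Σ₁ (λ q → guard (q ℕ.≟ p) (+ 1)) (e * p)
  ≡⟨ cong₂ _+ᶻ_ old-primes new-prime ⟩
    Σ₁ (λ q → guard (prime? q ×-dec (q ∣? e)) (+ 1)) e +ᶻ + 1
  ≡⟨ cong (_+ᶻ + 1) (sym (Σ₁-count (λ q → prime? q ×-dec (q ∣? e)) e)) ⟩
    + ω e +ᶻ + 1
  ≡⟨ trans (sym (ℤP.pos-+ (ω e) 1)) (cong +_ (ℕP.+-comm (ω e) 1)) ⟩
    + suc (ω e) ∎)
  where
  open ≡-Reasoning
  instance
    _ : ℕ.NonZero p
    _ = prime⇒nonZero pr
    _ : ℕ.NonZero e
    _ = ℕ.>-nonZero 0<e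
  -- q is a prime divisor of e·p iff it is a prime divisor of e or q = p, exclusively.
  indicator : ∀ q → guard (prime? q ×-dec (q ∣? e * p)) (+ 1) ≡ guard (prime? q ×-dec (q ∣? e)) (+ 1) +ᶻ guard (q ℕ.≟ p) (+ 1)
  indicator q with q ℕ.≟ p
  ... | yes refl = begin
      guard (prime? q ×-dec (q ∣? e * p)) (+ 1)
    ≡⟨ guard-yes (prime? q ×-dec (q ∣? e * p)) _ (pr , n∣m*n e) ⟩
      + 1
    ≡⟨ cong (_+ᶻ + 1) (sym (guard-no (prime? q ×-dec (q ∣? e)) _ (¬p∣e ∘ proj₂))) ⟩
      guard (prime? q ×-dec (q ∣? e)) (+ 1) +ᶻ + 1 ∎
  ... | no q≢p = trans
    (guard-iff (prime? q ×-dec (q ∣? e * p)) (prime? q ×-dec (q ∣? e)) _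
      (λ (prq , q∣ep) → prq , [ (λ q∣e → q∣e) , (λ q≡p → ⊥-elim (q≢p q≡p)) ]′ (prime∣product e pr prq q∣ep))
      (λ (prq , q∣e) → prq , ∣-trans q∣e (m∣m*n p)))
    (sym (ℤP.+-identityʳ _))
  old-primes : Σ₁ (λ q → guard (prime? q ×-dec (q ∣? e)) (+ 1)) (e * p) ≡ Σ₁ (λ q → guard (prime? q ×-dec (q ∣? e)) (+ 1)) e
  old-primes = Σ₁-beyond e (e * p) _ (ℕP.m≤m*n e p)
    (λ q e<q → guard-no (prime? q ×-dec (q ∣? e)) _ (λ (_ , q∣e) → ℕP.<⇒≱ e<q (∣⇒≤⁺ 0<e q∣e)))
  new-prime : Σ₁ (λ q → guard (q ℕ.≟ p) (+ 1)) (e * p) ≡ + 1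
  new-prime = trans (Σ₁-single (e * p) p _ (ℕP.≤-trans (s≤s z≤n) (prime≥2 pr)) (ℕP.m≤n*m p e) (λ q _ _ q≢p → guard-no (q ℕ.≟ p) _ q≢p))
    (guard-yes (p ℕ.≟ p) _ refl)

μ-step : ∀ p e → Prime p → ¬ p ∣ e → 0 < e → μ (e * p) ≡ - μ e
-- Both μ values are computed by the square test: a square factor transfers
-- between e·p and e in both directions, and in the squarefree case the prime
-- count grows by one, flipping the sign.
μ-step p (suc m) pr ¬p∣e _ with suc m * p in eq
... | zero = ⊥-elim (ℕP.<⇒≢ (ℕP.<-≤-trans (ℕP.≤-trans (s≤s z≤n) (prime≥2 pr)) (ℕP.m≤n*m p (suc m))) (sym eq))
... | suc m' with squareFactor? m' | squareFactor? m
...   | yes _ | yes _ = refl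
...   | no ¬sq | yes (k , 2≤k , kk∣) = ⊥-elim (¬sq (squareFactor m' (toℕ k) 2≤k (subst (toℕ k * toℕ k ∣_) eq (∣-trans kk∣ (m∣m*n p)))))
...   | yes (k , 2≤k , kk∣) | no ¬sq = ⊥-elim (¬sq (squareFactor m (toℕ k) 2≤k (square∣⇒square∣ {k = toℕ k} pr ¬p∣e (subst (toℕ k * toℕ k ∣_) (sym eq) kk∣))))
...   | no _ | no _ rewrite trans (cong ω (sym eq)) (ω-step p (suc m) pr ¬p∣e (s≤s z≤n)) = refl

-- μ(e·p) = 0 for a prime p dividing e, since p² ∣ e·p.
μ-square : ∀ p e → Prime p → 0 < e → p ∣ e → μ (e * p) ≡ + 0
μ-square p e pr 0<e p∣e = μ-squareful (e * p) p
  (ℕP.<-≤-trans (ℕP.≤-trans (s≤s z≤n) (prime≥2 pr)) (ℕP.m≤n*m p e {{ℕ.>-nonZero 0<e}})) (prime≥2 pr) (*-monoˡ-∣ p p∣e)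

prime-factor : ∀ N → 2 ≤ N → ∃ λ p → ∃ λ K → Prime p × N ≡ K * p
prime-factor (suc N) 2≤N with factorise (suc N)
... | record { factors = [] ; isFactorisation = eq } = ⊥-elim (ℕP.<⇒≢ 2≤N (sym eq))
... | record { factors = p ∷ ps ; isFactorisation = eq ; factorsPrime = pr ∷ _ } =
  p , product ps , pr , trans eq (ℕP.*-comm p (product ps))

-- Möbius inversion at N = K·p with p prime: Σ_{d ∣ N} μ(d) = 0.
-- The divisors of N not divisible by p are those of K; the others are the
-- e·p with e ∣ K, and they contribute -μ(e) when p ∤ e and 0 otherwise.
mobius-sum-prime : ∀ p K → Prime p → 0 < K → Σ₁ (λ d → guard (d ∣? K * p) (μ d)) (K * p) ≡ + 0
mobius-sum-prime p K pr 0<K = begin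
    Σ₁ (λ d → guard (d ∣? N) (μ d)) N
  ≡⟨ Σ₁-cong N _ _ (λ d _ _ → guard-split (d ∣? N) (p ∣? d) (μ d)) ⟩
    Σ₁ (λ d → coprimeTerm d +ᶻ multipleTerm d) N
  ≡⟨ Σ₁-+ N coprimeTerm multipleTerm ⟩
    Σ₁ coprimeTerm N +ᶻ Σ₁ multipleTerm N
  ≡⟨ cong₂ _+ᶻ_ coprime-sum multiple-sum ⟩
    Σ₁ coprimeTermK K +ᶻ - Σ₁ coprimeTermK K
  ≡⟨ ℤP.+-inverseʳ (Σ₁ coprimeTermK K) ⟩
    + 0 ∎
  where
  open ≡-Reasoning
  N = K * p
  instance
    _ : ℕ.NonZero p
    _ = prime⇒nonZero pr
  coprimeTerm multipleTerm coprimeTermK : ℕ → ℤ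
  coprimeTerm d  = guard (d ∣? N ×-dec ¬? (p ∣? d)) (μ d)
  multipleTerm d = guard (d ∣? N ×-dec p ∣? d) (μ d)
  coprimeTermK d = guard (d ∣? K ×-dec ¬? (p ∣? d)) (μ d)

  coprime-sum : Σ₁ coprimeTerm N ≡ Σ₁ coprimeTermK K
  coprime-sum = trans
    (Σ₁-cong N _ _ (λ d _ _ → guard-iff (d ∣? N ×-dec ¬? (p ∣? d)) (d ∣? K ×-dec ¬? (p ∣? d)) _
      (λ (d∣N , ¬p∣d) → coprime-divisor (¬∣⇒coprime pr ¬p∣d) (subst (d ∣_) (ℕP.*-comm K p) d∣N) , ¬p∣d)
      (λ (d∣K , ¬p∣d) → ∣-trans d∣K (m∣m*n p) , ¬p∣d)))
    (Σ₁-beyond K N coprimeTermK (ℕP.m≤m*n K p)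
      (λ d K<d → guard-no (d ∣? K ×-dec ¬? (p ∣? d)) _ (λ (d∣K , _) → ℕP.<⇒≱ K<d (∣⇒≤⁺ 0<K d∣K))))

  multipleTerm-at : ∀ e → 1 ≤ e → multipleTerm (e * p) ≡ - coprimeTermK e
  multipleTerm-at e 1≤e with e ∣? K | p ∣? e
  ... | yes e∣K | no ¬p∣e = trans
    (guard-yes ((e * p) ∣? N ×-dec p ∣? (e * p)) _ (*-monoˡ-∣ p e∣K , n∣m*n e))
    (μ-step p e pr ¬p∣e 1≤e)
  ... | yes _   | yes p∣e = trans (cong (guard _) (μ-square p e pr 1≤e p∣e)) (guard-0 _)
  ... | no ¬e∣K | _       = guard-no ((e * p) ∣? N ×-dec p ∣? (e * p)) _ (λ (ep∣N , _) → ¬e∣K (*-cancelʳ-∣ p ep∣N))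

  multiple-sum : Σ₁ multipleTerm N ≡ - Σ₁ coprimeTermK K
  multiple-sum = begin
      Σ₁ multipleTerm N
    ≡⟨ Σ₁-multiples p K multipleTerm (ℕP.≤-trans (s≤s z≤n) (prime≥2 pr))
         (λ d ¬p∣d → guard-no (d ∣? N ×-dec p ∣? d) _ (¬p∣d ∘ proj₂)) ⟩
      Σ₁ (λ e → multipleTerm (e * p)) K
    ≡⟨ Σ₁-cong K _ _ (λ e 1≤e _ → multipleTerm-at e 1≤e) ⟩
      Σ₁ (λ e → - coprimeTermK e) K
    ≡⟨ Σ₁-neg K coprimeTermK ⟩
      - Σ₁ coprimeTermK K ∎

mobius-sum : ∀ N M → 2 ≤ N → N ≤ M → Σ₁ (λ d → guard (d ∣? N) (μ d)) M ≡ + 0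
mobius-sum N M 2≤N N≤M with prime-factor N 2≤N
... | p , K , pr , refl = trans
  (Σ₁-beyond (K * p) M _ N≤M (λ d N<d → guard-no (d ∣? K * p) _ (λ d∣N → ℕP.<⇒≱ N<d (∣⇒≤⁺ (ℕP.<-trans (s≤s z≤n) 2≤N) d∣N))))
  (mobius-sum-prime p K pr (0<K K 2≤N))
  where
  0<K : ∀ K → 2 ≤ K * p → 0 < K
  0<K (suc _) _ = s≤s z≤n

-- Scaled form: if a ∣ z and a < z, then Σ_{d ≤ M, d·a ∣ z} μ(d) = 0 for M ≥ z,
-- since d·a ∣ z iff d ∣ z/a and z/a ≥ 2.
mobius-sum-scaled : ∀ a z M → 0 < a → a ∣ z → a < z → z ≤ M → Σ₁ (λ d → guard (d * a ∣? z) (μ d)) M ≡ + 0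
mobius-sum-scaled a z M 0<a (divides N refl) a<z z≤M = trans
  (Σ₁-cong M _ _ (λ d _ _ → guard-iff (d * a ∣? N * a) (d ∣? N) (μ d) (*-cancelʳ-∣ a) (*-monoˡ-∣ a)))
  (mobius-sum N M (2≤N N a<z) (ℕP.≤-trans (ℕP.m≤m*n N a) z≤M))
  where
  instance
    _ : ℕ.NonZero a
    _ = ℕ.>-nonZero 0<a
  2≤N : ∀ N → a < N * a → 2 ≤ N
  2≤N zero          a<0  = ⊥-elim (ℕP.<⇒≱ a<0 z≤n)
  2≤N (suc zero)    a<a  = ⊥-elim (ℕP.<-irrefl (sym (ℕP.+-identityʳ a)) a<a)
  2≤N (suc (suc N)) _    = s≤s (s≤s z≤n)

gcdList-∣ : ∀ {n} (x : Fin n → ℕ) (L : List (Fin n)) {k} → k ∈ L → gcdList (map x L) ∣ x k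
gcdList-∣ x (k ∷ L) (here refl) = gcd[m,n]∣m (x k) _
gcdList-∣ x (k ∷ L) (there k∈L) = ∣-trans (gcd[m,n]∣n (x k) _) (gcdList-∣ x L k∈L)

-- Every element of D_S(x_j) is a proper divisor of x_j: it divides some
-- greatest-type divisor of x_j.
DS-proper : ∀ {n} (x : Fin n → ℕ) → Positive x → ∀ j z → InDS x j z → z ∣ x j × z < x j
DS-proper x pos j z (k ∷ L , _ , _ , (k<j , k∣j , _) ∷ _ , refl) =
  ∣-trans z∣k k∣j , ℕP.≤-<-trans (∣⇒≤⁺ (pos k) z∣k) k<j
  where
  z∣k : gcdList (map x (k ∷ L)) ∣ x k
  z∣k = gcdList-∣ x (k ∷ L) (here refl)

module GreatestTypeDivisors {n} (x : Fin n → ℕ) (pos : Positive x) (j : Fin n) where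

  refine : ∀ t → x t ∣ x j → x t < x j → ¬ IsGTD x t j →
    ∃ λ t' → x t ∣ x t' × x t' ∣ x j × x t < x t' × x t' < x j
  refine t t∣j t<j ¬gtd with ¬∀⟶∃¬ n _ between? (λ h → ¬gtd (t<j , t∣j , h))
    where
    between? : ∀ t' → Dec ((x t ∣ x t') × (x t' ∣ x j) → (x t' ≡ x t) ⊎ (x t' ≡ x j))
    between? t' = ((x t ∣? x t') ×-dec (x t' ∣? x j)) →-dec ((x t' ℕ.≟ x t) ⊎-dec (x t' ℕ.≟ x j))
  ... | t' , ¬between with (x t ∣? x t') ×-dec (x t' ∣? x j)
  ...   | no ¬divides = ⊥-elim (¬between (⊥-elim ∘ ¬divides))
  ...   | yes (t∣t' , t'∣j) = t' , t∣t' , t'∣j ,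
    ℕP.≤∧≢⇒< (∣⇒≤⁺ (pos t') t∣t') (λ t≡t' → ¬between (λ _ → inj₁ (sym t≡t'))) ,
    ℕP.≤∧≢⇒< (∣⇒≤⁺ (pos j) t'∣j) (λ t'≡j → ¬between (λ _ → inj₂ t'≡j))

  -- Every proper divisor of x_j in S divides a greatest-type divisor of x_j
  -- (climb along refine; x_j - x_t decreases).
  below-gtd : ∀ t → x t ∣ x j → x t < x j → ∃ λ k → IsGTD x k j × x t ∣ x k
  below-gtd t = climb t (<-wellFounded (x j ∸ x t))
    where
    climb : ∀ t → Acc _<_ (x j ∸ x t) → x t ∣ x j → x t < x j → ∃ λ k → IsGTD x k j × x t ∣ x k
    climb t (acc smaller) t∣j t<j with isGTD? x t j
    ... | yes gtd = t , gtd , ∣-refl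
    ... | no ¬gtd with refine t t∣j t<j ¬gtd
    ...   | t' , t∣t' , t'∣j , t<t' , t'<j with climb t' (smaller (ℕP.∸-monoʳ-< t<t' (ℕP.<⇒≤ t'<j))) t'∣j t'<j
    ...     | k , gtd , t'∣k = k , gtd , ∣-trans t∣t' t'∣k

module Coefficient {n} (x : Fin n → ℕ) (pos : Positive x) (gc : GcdClosed x) (i j : Fin n)
  (a∣y : x i ∣ x j) (a<y : x i < x j) (disj : ∀ z → ¬ (InDS x j z × InD x i z)) where

  open GreatestTypeDivisors x pos j using (below-gtd)

  InK : Fin n → Set
  InK k = ((x i ∣ x k) × (x i < x k)) × IsGTD x k j

  inK? : ∀ k → Dec (InK k)
  inK? k = ((x i ∣? x k) ×-dec (x i <? x k)) ×-dec isGTD? x k j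

  K : List (Fin n)
  K = filter inK? (allFin n)

  K-unique : Unique K
  K-unique = Unique.filter⁺ inK? (Unique.allFin⁺ n)

  ∈K⇒ : ∀ {k} → k ∈ K → InK k
  ∈K⇒ k∈K = proj₂ (∈-filter⁻ inK? {xs = allFin n} k∈K)

  ⇒∈K : ∀ {k} → InK k → k ∈ K
  ⇒∈K inK = ∈-filter⁺ inK? (∈-allFin _) inK

  k∣y : ∀ {k} → k ∈ K → x k ∣ x j
  k∣y k∈K = proj₁ (proj₂ (proj₂ (∈K⇒ k∈K)))

  -- The condition on d in the definition of c_ij.
  Admissible? : ∀ d → Dec ((d * x i ∣ x j) × (∀ t → x t < x j → ¬ (d * x i ∣ x t)))
  Admissible? d = ((d * x i) ∣? x j) ×-dec all? (λ t → (x t <? x j) →-dec ¬? ((d * x i) ∣? x t))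

  a<da : ∀ {d} → 2 ≤ d → x i < d * x i
  a<da {d} 2≤d = subst (x i <_) (ℕP.*-comm (x i) d) (ℕP.m<m*n (x i) d {{ℕ.>-nonZero (pos i)}} 2≤d)

  -- For d ≥ 2, at most one member of K is a multiple of d·x_i: two distinct
  -- ones would have a gcd in D_S(x_j) that is a proper multiple of x_i.
  multiple-unique : ∀ {d k k'} → 2 ≤ d → k ∈ K → k' ∈ K → d * x i ∣ x k → d * x i ∣ x k' → k ≡ k'
  multiple-unique {d} {k} {k'} 2≤d k∈K k'∈K da∣k da∣k' with k ≟ᶠ k'
  ... | yes k≡k' = k≡k'
  ... | no k≢k' = ⊥-elim (disj (x g) (g∈DS , g∈D))
    where
    g = proj₁ (gc k k')
    g≡ : x g ≡ gcd (x k) (x k')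
    g≡ = proj₂ (gc k k')
    g∈DS : InDS x j (x g)
    g∈DS = k ∷ k' ∷ [] , (k≢k' ∷ []) ∷ [] ∷ [] , ℕP.≤-refl , proj₂ (∈K⇒ k∈K) ∷ proj₂ (∈K⇒ k'∈K) ∷ [] ,
           trans (cong (gcd (x k)) (gcd-identityʳ (x k'))) (sym g≡)
    g∈D : InD x i (x g)
    g∈D = (g , refl)
        , subst (x i ∣_) (sym g≡) (gcd-greatest (proj₁ (proj₁ (∈K⇒ k∈K))) (proj₁ (proj₁ (∈K⇒ k'∈K))))
        , ℕP.<-≤-trans (a<da 2≤d) (∣⇒≤⁺ (pos g) (subst (_ ∣_) (sym g≡) (gcd-greatest da∣k da∣k')))

  -- For d ≥ 2 with d·x_i ∣ x_j: if no member of K is a multiple of d·x_i then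
  -- no element of S below x_j is, since gcd(x_t, x_j) divides some
  -- greatest-type divisor of x_j, which would then lie in K.
  admissible : ∀ {d} → 2 ≤ d → d * x i ∣ x j → (∀ k → k ∈ K → ¬ (d * x i ∣ x k)) →
    ∀ t → x t < x j → ¬ (d * x i ∣ x t)
  admissible {d} 2≤d da∣y none t t<y da∣t with below-gtd g g∣y g<y
    where
    g = proj₁ (gc t j)
    g≡ : x g ≡ gcd (x t) (x j)
    g≡ = proj₂ (gc t j)
    g∣y : x g ∣ x j
    g∣y = subst (_∣ x j) (sym g≡) (gcd[m,n]∣n (x t) (x j))
    g<y : x g < x j
    g<y = ℕP.≤-<-trans (∣⇒≤⁺ (pos t) (subst (_∣ x t) (sym g≡) (gcd[m,n]∣m (x t) (x j)))) t<y
  ... | k , gtd , g∣k = none k (⇒∈K ((a∣k , ℕP.<-≤-trans (a<da 2≤d) (∣⇒≤⁺ (pos k) da∣k)) , gtd)) da∣k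
    where
    da∣k : d * x i ∣ x k
    da∣k = ∣-trans (subst (_ ∣_) (sym (proj₂ (gc t j))) (gcd-greatest da∣t da∣y)) g∣k
    a∣k : x i ∣ x k
    a∣k = ∣-trans (n∣m*n d) da∣k

  -- The admissible d are decomposed against three summands:
  -- the d with d·x_i ∣ x_j, the same test for each k ∈ K, and d = 1.
  all-multiples K-multiples δ₁ : ℕ → ℤ
  all-multiples d = guard (d * x i ∣? x j) (μ d)
  K-multiples d   = sumℤ (map (λ k → guard (d * x i ∣? x k) (μ d)) K)
  δ₁ d            = guard (d ℕ.≟ 1) (+ 1)

  c : ℤ
  c = + length K - + 1

  -- d = 1 is not admissible (x_i itself lies below x_j), while it is counted
  -- once in all-multiples and |K| times in K-multiples.
  term-one : guard (Admissible? 1) (μ 1) ≡ (all-multiples 1 - K-multiples 1) +ᶻ c *ᶻ δ₁ 1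
  term-one = begin
      guard (Admissible? 1) (μ 1)
    ≡⟨ guard-no (Admissible? 1) _ (λ (_ , minimal) → minimal i a<y (∣-reflexive (ℕP.*-identityˡ (x i)))) ⟩
      + 0
    ≡⟨ cancel (+ length K) ⟩
      (+ 1 - + length K) +ᶻ c *ᶻ + 1
    ≡⟨ sym (cong₂ (λ u v → (u - v) +ᶻ c *ᶻ + 1) all-one K-one) ⟩
      (all-multiples 1 - K-multiples 1) +ᶻ c *ᶻ δ₁ 1 ∎
    where
    open ≡-Reasoning
    cancel : ∀ l → + 0 ≡ (+ 1 - l) +ᶻ (l - + 1) *ᶻ + 1
    cancel = solve-∀
    1a∣ : ∀ {m} → x i ∣ m → 1 * x i ∣ m
    1a∣ = subst (_∣ _) (sym (ℕP.*-identityˡ (x i)))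
    all-one : all-multiples 1 ≡ + 1
    all-one = guard-yes (1 * x i ∣? x j) _ (1a∣ a∣y)
    K-one : K-multiples 1 ≡ + length K
    K-one = sumℤ-ones _ K (λ k k∈K → guard-yes (1 * x i ∣? x k) _ (1a∣ (proj₁ (proj₁ (∈K⇒ k∈K)))))

  -- For d ≥ 2: if d·x_i ∤ x_j all terms vanish; otherwise either exactly one
  -- k ∈ K has d·x_i ∣ x_k and d is not admissible, or none has and d is admissible.
  term-above-one : ∀ {d} → 2 ≤ d → guard (Admissible? d) (μ d) ≡ all-multiples d - K-multiples d
  term-above-one {d} 2≤d = by-cases (d * x i ∣? x j) (any? (λ k → d * x i ∣? x k) K)
    where
    open ≡-Reasoning
    K-multiples-none : (∀ k → k ∈ K → ¬ (d * x i ∣ x k)) → K-multiples d ≡ + 0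
    K-multiples-none none = sumℤ-zero _ K (λ k k∈K → guard-no (d * x i ∣? x k) _ (none k k∈K))
    by-cases : Dec (d * x i ∣ x j) → Dec (Any (λ k → d * x i ∣ x k) K) →
      guard (Admissible? d) (μ d) ≡ all-multiples d - K-multiples d
    by-cases (no ¬da∣y) _ = begin
        guard (Admissible? d) (μ d)
      ≡⟨ guard-no (Admissible? d) _ (¬da∣y ∘ proj₁) ⟩
        + 0 - + 0
      ≡⟨ sym (cong₂ _-_ (guard-no (d * x i ∣? x j) _ ¬da∣y)
           (K-multiples-none (λ k k∈K da∣k → ¬da∣y (∣-trans da∣k (k∣y k∈K))))) ⟩
        all-multiples d - K-multiples d ∎
    by-cases (yes da∣y) (yes some) = let k₁ , k₁∈K , da∣k₁ = find some in begin
        guard (Admissible? d) (μ d)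
      ≡⟨ guard-no (Admissible? d) _ (λ (_ , minimal) → minimal k₁ (proj₁ (proj₂ (∈K⇒ k₁∈K))) da∣k₁) ⟩
        + 0
      ≡⟨ sym (ℤP.+-inverseʳ (μ d)) ⟩
        μ d - μ d
      ≡⟨ sym (cong₂ _-_ (guard-yes (d * x i ∣? x j) _ da∣y)
           (sumℤ-unique (λ k → d * x i ∣? x k) (μ d) K k₁ K-unique k₁∈K da∣k₁
             (λ k k∈K da∣k → multiple-unique 2≤d k∈K k₁∈K da∣k da∣k₁))) ⟩
        all-multiples d - K-multiples d ∎
    by-cases (yes da∣y) (no none) = begin
        guard (Admissible? d) (μ d)
      ≡⟨ guard-yes (Admissible? d) _ (da∣y , admissible 2≤d da∣y none′) ⟩
        μ d
      ≡⟨ sym (ℤP.+-identityʳ (μ d)) ⟩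
        μ d - + 0
      ≡⟨ sym (cong₂ _-_ (guard-yes (d * x i ∣? x j) _ da∣y) (K-multiples-none none′)) ⟩
        all-multiples d - K-multiples d ∎
      where
      none′ : ∀ k → k ∈ K → ¬ (d * x i ∣ x k)
      none′ k k∈K da∣k = none (lose k∈K da∣k)

  term : ∀ d → 1 ≤ d → guard (Admissible? d) (μ d) ≡ (all-multiples d - K-multiples d) +ᶻ c *ᶻ δ₁ d
  term 1             _ = term-one
  term d@(suc (suc _)) _ = begin
      guard (Admissible? d) (μ d)
    ≡⟨ term-above-one {d} (s≤s (s≤s z≤n)) ⟩
      all-multiples d - K-multiples d
    ≡⟨ sym (ℤP.+-identityʳ _) ⟩
      (all-multiples d - K-multiples d) +ᶻ + 0
    ≡⟨ cong ((all-multiples d - K-multiples d) +ᶻ_) (sym (ℤP.*-zeroʳ c)) ⟩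
      (all-multiples d - K-multiples d) +ᶻ c *ᶻ δ₁ d ∎
    where open ≡-Reasoning

  -- Each of the first two summands is a Möbius sum over the divisors of a
  -- quotient ≥ 2, hence vanishes.
  all-multiples-sum : Σ₁ all-multiples (x j) ≡ + 0
  all-multiples-sum = mobius-sum-scaled (x i) (x j) (x j) (pos i) a∣y a<y ℕP.≤-refl

  K-multiples-sum : Σ₁ K-multiples (x j) ≡ + 0
  K-multiples-sum = trans (Σ₁-sumℤ (λ k d → guard (d * x i ∣? x k) (μ d)) K (x j))
    (sumℤ-zero _ K (λ k k∈K → let ((a∣k , a<k) , k<y , _) = ∈K⇒ k∈K in
      mobius-sum-scaled (x i) (x k) (x j) (pos i) a∣k a<k (ℕP.<⇒≤ k<y)))

  δ₁-sum : Σ₁ δ₁ (x j) ≡ + 1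
  δ₁-sum = Σ₁-single (x j) 1 δ₁ (s≤s z≤n) (pos j) (λ d _ _ d≢1 → guard-no (d ℕ.≟ 1) _ d≢1)

  cCoeff≡ : cCoeff x i j ≡ c
  cCoeff≡ = begin
      cCoeff x i j
    ≡⟨ Σ₁-filter Admissible? μ (x j) ⟩
      Σ₁ (λ d → guard (Admissible? d) (μ d)) (x j)
    ≡⟨ Σ₁-cong (x j) _ _ (λ d 1≤d _ → term d 1≤d) ⟩
      Σ₁ (λ d → (all-multiples d - K-multiples d) +ᶻ c *ᶻ δ₁ d) (x j)
    ≡⟨ Σ₁-+ (x j) _ _ ⟩
      Σ₁ (λ d → all-multiples d - K-multiples d) (x j) +ᶻ Σ₁ (λ d → c *ᶻ δ₁ d) (x j)
    ≡⟨ cong₂ _+ᶻ_ (Σ₁-+ (x j) all-multiples (λ d → - K-multiples d)) (Σ₁-scale (x j) c δ₁) ⟩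
      (Σ₁ all-multiples (x j) +ᶻ Σ₁ (λ d → - K-multiples d) (x j)) +ᶻ c *ᶻ Σ₁ δ₁ (x j)
    ≡⟨ cong₂ (λ u v → (u +ᶻ v) +ᶻ c *ᶻ Σ₁ δ₁ (x j)) all-multiples-sum (trans (Σ₁-neg (x j) K-multiples) (cong -_ K-multiples-sum)) ⟩
      + 0 +ᶻ c *ᶻ Σ₁ δ₁ (x j)
    ≡⟨ trans (ℤP.+-identityˡ _) (cong (c *ᶻ_) δ₁-sum) ⟩
      c *ᶻ + 1
    ≡⟨ ℤP.*-identityʳ c ⟩
      c ∎
    where open ≡-Reasoning

lemma2p5 : ∀ {n} (x : Fin n → ℕ) → Distinct x → Positive x → GcdClosed x →
    (i j : Fin n) → InDS x j (x i) → (∀ (z : ℕ) → ¬ (InDS x j z × InD x i z)) →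
    cCoeff x i j ≡ + lCount x i j - + 1
lemma2p5 x _ pos gc i j xi∈DS disj = Coefficient.cCoeff≡ x pos gc i j xi∣xj xi<xj disj
  where
  xi∣xj = proj₁ (DS-proper x pos j (x i) xi∈DS)
  xi<xj = proj₂ (DS-proper x pos j (x i) xi∈DS)
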